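{- Let $P$ be an $\mathsf{eLNDT}$ derivation of a sequent $\Gamma\to\Delta$ from a set of extension axioms $\mathcal A=\{e_i\leftrightarrow A_i\}_{i<n}$. Then there is a $\mathsf{posELNDT}_{ - }$ derivation of $N(\Gamma)\to N(\Delta)$ from the extension axioms $N(\mathcal A)=\{e_i\leftrightarrow N(A_i)\}_{i<n}$, of size polynomial in $|P|$.
   Context: eNDT formulas: built from propositional variables, constants $0,1$ and extension variables $e_0,e_1,\dots$ by $\vee$ and decisions $\mathrm{dec}(A,p,B)$ ("if $p$ then $B$ else $A$"; the decision variable must not be an extension variable). Extension axioms $\{e_i\leftrightarrow A_i\}_{i<n}$ with $A_i$ using only $e_0,\dots,e_{i-1}$; $e\leftrightarrow A$ stands for the sequents $e\to A$ and $A\to e$. Sequents $\Gamma\to\Delta$ on multisets. $\mathrm{pd}(A,p,C):=\mathrm{dec}(A,p,A\vee C)$; positive formulas have only decisions of this form. $\mathsf{eLNDT}$: initial sequents $0\to$, $\to1$, $p\to p$; cut; left/right weakening and contraction; $\vee$-left (from $\Gamma,A\to\Delta$ and $\Gamma,B\to\Delta$ infer $\Gamma,A\vee B\to\Delta$); $\vee$-right (from $\Gamma\to\Delta,A,B$ infer $\Gamma\to\Delta,A\vee B$); decision left (from $\Gamma,A\to\Delta,p$ and $\Gamma,p,B\to\Delta$ infer $\Gamma,\mathrm{dec}(A,p,B)\to\Delta$) and right (from $\Gamma\to\Delta,A,p$ and $\Gamma,p\to\Delta,B$ infer $\Gamma\to\Delta,\mathrm{dec}(A,p,B)$). A derivation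 from $\mathcal A$ is a finite list of sequents each being an axiom sequent of $\mathcal A$ or following from earlier ones by a rule. $\mathsf{posELNDT}_{ - }$: the language is extended by a negative literal $\bar p$ for each propositional variable $p$, treated as an additional atom which may also serve as a decision variable. Rules: the initial sequents, cut, structural and $\vee$ rules above; positive decision rules (from $\Gamma,A\to\Delta$ and $\Gamma,x,B\to\Delta$ infer $\Gamma,\mathrm{pd}(A,x,B)\to\Delta$; from $\Gamma\to\Delta,A,x$ and $\Gamma\to\Delta,A,B$ infer $\Gamma\to\Delta,\mathrm{pd}(A,x,B)$; $x$ a propositional variable or negative literal); extra initial sequents $p,\bar p\to$ and $\to p,\bar p$. All formulas and extension axioms must be positive. Translation $N$: $N(0)=0$, $N(1)=1$, $N(p)=p$, $N(e_i)=e_i$, $N(A\vee B)=N(A)\vee N(B)$, $N(\mathrm{dec}(A,p,B))=\mathrm{pd}(0,\bar p,N(A))\vee\mathrm{pd}(0,p,N(B))$; extended elementwise to multisets. Size = number of symbols. -}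

module Defs where

open import Data.Nat using (ℕ; zero; suc; _+_; _<_)
open import Data.Fin using (Fin; toℕ)
open import Data.List using (List; []; _∷_; map; length; lookup)
open import Data.List.Relation.Unary.All using (All)
open import Data.List.Relation.Unary.Any using (Any)
open import Data.List.Relation.Binary.Permutation.Propositional using (_↭_)
open import Data.Product using (Σ; ∃; ∃-syntax; _×_; _,_; proj₁; proj₂)
open import Data.Sum using (_⊎_)
open import Relation.Binary.PropositionalEquality using (_≡_)

-- Literals: a propositional variable p_i (pos i) or a negative literal p̄_i (neg i).
-- Negative literals only occur in posELNDT_-.
data Lit : Set where
  pos : ℕ → Lit
  neg : ℕ → Lit

-- Formulas: constants 0,1, literals, extension variables e_i, ∨ and
-- decisions dec(A,x,B) = "if x then B else A" (decision variable is a literal,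
-- never an extension variable).
data Fm : Set where
  𝟘 𝟙  : Fm
  lit  : Lit → Fm
  ext  : ℕ → Fm
  _∨_  : Fm → Fm → Fm
  dec  : Fm → Lit → Fm → Fm

pd : Fm → Lit → Fm → Fm
pd A x C = dec A x (A ∨ C)

-- eLNDT formulas: no negative literals.
data Plain : Fm → Set where
  𝟘  : Plain 𝟘
  𝟙  : Plain 𝟙
  var : ∀ p → Plain (lit (pos p))
  ext : ∀ i → Plain (ext i)
  _∨_ : ∀ {A B} → Plain A → Plain B → Plain (A ∨ B)
  dec : ∀ {A B} p → Plain A → Plain B → Plain (dec A (pos p) B)

data Positive : Fm → Set where
  𝟘  : Positive 𝟘
  𝟙  : Positive 𝟙
  lit : ∀ x → Positive (lit x)
  ext : ∀ i → Positive (ext i)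
  _∨_ : ∀ {A B} → Positive A → Positive B → Positive (A ∨ B)
  posPd : ∀ {A C} x → Positive A → Positive C → Positive (pd A x C)

data ExtBelow (i : ℕ) : Fm → Set where
  𝟘  : ExtBelow i 𝟘
  𝟙  : ExtBelow i 𝟙
  lit : ∀ x → ExtBelow i (lit x)
  ext : ∀ {j} → j < i → ExtBelow i (ext j)
  _∨_ : ∀ {A B} → ExtBelow i A → ExtBelow i B → ExtBelow i (A ∨ B)
  dec : ∀ {A B} x → ExtBelow i A → ExtBelow i B → ExtBelow i (dec A x B)

-- Sequents (multisets represented by lists, compared up to permutation)

Seq : Set
Seq = List Fm × List Fm

_≈S_ : Seq → Seq → Set
(Γ , Δ) ≈S (Γ' , Δ') = (Γ ↭ Γ') × (Δ ↭ Δ')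

-- Extension axioms {e_i ↔ A_i}_{i<n}, given as the list [A_0,…,A_{n-1}].
-- Axiom sequents: e_i → A_i and A_i → e_i.
data ExtAx (𝒜 : List Fm) : Seq → Set where
  ax→ : (i : Fin (length 𝒜)) →
        ExtAx 𝒜 (ext (toℕ i) ∷ [] , lookup 𝒜 i ∷ [])
  ax← : (i : Fin (length 𝒜)) →
        ExtAx 𝒜 (lookup 𝒜 i ∷ [] , ext (toℕ i) ∷ [])

WellFormedExt : List Fm → Set
WellFormedExt 𝒜 = (i : Fin (length 𝒜)) →
  Plain (lookup 𝒜 i) × ExtBelow (toℕ i) (lookup 𝒜 i)

data Common : List Seq → Seq → Set where
  init0 : Common [] (𝟘 ∷ [] , [])
  init1 : Common [] ([] , 𝟙 ∷ [])
  initx : ∀ x → Common [] (lit x ∷ [] , lit x ∷ [])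
  cut   : ∀ Γ Δ A → Common ((Γ , A ∷ Δ) ∷ (A ∷ Γ , Δ) ∷ []) (Γ , Δ)
  wL    : ∀ Γ Δ A → Common ((Γ , Δ) ∷ []) (A ∷ Γ , Δ)
  wR    : ∀ Γ Δ A → Common ((Γ , Δ) ∷ []) (Γ , A ∷ Δ)
  cL    : ∀ Γ Δ A → Common ((A ∷ A ∷ Γ , Δ) ∷ []) (A ∷ Γ , Δ)
  cR    : ∀ Γ Δ A → Common ((Γ , A ∷ A ∷ Δ) ∷ []) (Γ , A ∷ Δ)
  ∨L    : ∀ Γ Δ A B → Common ((A ∷ Γ , Δ) ∷ (B ∷ Γ , Δ) ∷ []) (A ∨ B ∷ Γ , Δ)
  ∨R    : ∀ Γ Δ A B → Common ((Γ , A ∷ B ∷ Δ) ∷ []) (Γ , A ∨ B ∷ Δ)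

data LNDTRule : List Seq → Seq → Set where
  common : ∀ {ps c} → Common ps c → LNDTRule ps c
  decL   : ∀ Γ Δ A x B →
           LNDTRule ((A ∷ Γ , lit x ∷ Δ) ∷ (lit x ∷ B ∷ Γ , Δ) ∷ [])
                    (dec A x B ∷ Γ , Δ)
  decR   : ∀ Γ Δ A x B →
           LNDTRule ((Γ , A ∷ lit x ∷ Δ) ∷ (lit x ∷ Γ , B ∷ Δ) ∷ [])
                    (Γ , dec A x B ∷ Δ)

data PosRule : List Seq → Seq → Set where
  common : ∀ {ps c} → Common ps c → PosRule ps c
  pdL    : ∀ Γ Δ A x B →
           PosRule ((A ∷ Γ , Δ) ∷ (lit x ∷ B ∷ Γ , Δ) ∷ [])
                   (pd A x B ∷ Γ , Δ)
  pdR    : ∀ Γ Δ A x B →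
           PosRule ((Γ , A ∷ lit x ∷ Δ) ∷ (Γ , A ∷ B ∷ Δ) ∷ [])
                   (Γ , pd A x B ∷ Δ)
  compL  : ∀ p → PosRule [] (lit (pos p) ∷ lit (neg p) ∷ [] , [])
  compR  : ∀ p → PosRule [] ([] , lit (pos p) ∷ lit (neg p) ∷ [])

-- The list is stored in REVERSE
-- order: the head is the last line; each line is an axiom sequent or
-- follows by a rule instance from lines occurring earlier (i.e. in the tail),
-- with all sequents compared as multisets.

Follows : (List Seq → Seq → Set) → List Seq → Seq → Set
Follows R earlier s =
  ∃[ ps ] ∃[ c ] (R ps c × c ≈S s × All (λ p → Any (λ q → p ≈S q) earlier) ps)

data Valid (R : List Seq → Seq → Set) (Ax : Seq → Set) : List Seq → Set where
  []  : Valid R Ax []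
  ax  : ∀ {s ss} → Ax s → Valid R Ax ss → Valid R Ax (s ∷ ss)
  rule : ∀ {s ss} → Follows R ss s → Valid R Ax ss → Valid R Ax (s ∷ ss)

SeqAll : (Fm → Set) → Seq → Set
SeqAll P (Γ , Δ) = All P Γ × All P Δ

data EndsWith : List Seq → Seq → Set where
  ends : ∀ {s s' ss} → s ≈S s' → EndsWith (s ∷ ss) s'

IsELNDTDerivation : List Fm → List Seq → Seq → Set
IsELNDTDerivation 𝒜 P S =
  Valid LNDTRule (ExtAx 𝒜) P × All (SeqAll Plain) P × EndsWith P S

IsPosDerivation : List Fm → List Seq → Seq → Set
IsPosDerivation 𝒜' Q S =
  Valid PosRule (ExtAx 𝒜') Q × All (SeqAll Positive) Q × EndsWith Q S

bar : Lit → Lit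
bar (pos p) = neg p
bar (neg p) = pos p

N : Fm → Fm
N 𝟘 = 𝟘
N 𝟙 = 𝟙
N (lit x) = lit x
N (ext i) = ext i
N (A ∨ B) = N A ∨ N B
N (dec A x B) = pd 𝟘 (bar x) (N A) ∨ pd 𝟘 x (N B)

fmSize : Fm → ℕ
fmSize 𝟘 = 1
fmSize 𝟙 = 1
fmSize (lit x) = 1
fmSize (ext i) = 1
fmSize (A ∨ B) = suc (fmSize A + fmSize B)
fmSize (dec A x B) = suc (suc (fmSize A + fmSize B))

listSize : List Fm → ℕ
listSize [] = 0
listSize (A ∷ Γ) = fmSize A + listSize Γ

-- one extra symbol for the arrow
seqSize : Seq → ℕ
seqSize (Γ , Δ) = suc (listSize Γ + listSize Δ)

derivSize : List Seq → ℕ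
derivSize [] = 0
derivSize (s ∷ ss) = seqSize s + derivSize ss

-- N sends every eLNDT rule other than a decision rule to the posELNDT₋ rule of
-- the same name. For a decision on x the translated principal formula is
-- pd(0,x̄,N A) ∨ pd(0,x,N B); it is derived from the translated premises by a
-- fixed derivation in the empty side context, built from the complement
-- sequents x, x̄ → and → x, x̄ and cuts on x, into which the side formulas are
-- then inserted everywhere, at the price of weakening its initial sequents. A
-- line of size n thus costs at most 77·(6n)³ symbols, and as cubes are
-- superadditive the whole translation has size O(|P|³).
module Submission where

open import Defs
open import Data.Nat using (ℕ; suc; _+_; _*_; _^_; _≤_; z≤n; s≤s)
open import Data.Nat.Properties
open import Data.Nat.ListAction using (sum)
open import Data.Nat.ListAction.Properties using (sum-↭)
open import Data.Nat.Tactic.RingSolver using (solve-∀)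
open import Data.Fin using (Fin; zero; suc; toℕ)
open import Data.List using (List; []; _∷_; map; length; lookup; _++_)
open import Data.List.Relation.Unary.All using (All; []; _∷_)
import Data.List.Relation.Unary.All as All
import Data.List.Relation.Unary.All.Properties as All
open import Data.List.Relation.Unary.Any using (Any; here; there)
import Data.List.Relation.Unary.Any as Any
open import Data.List.Relation.Binary.Permutation.Propositional
  using (_↭_; ↭-refl; ↭-sym; ↭-trans; prep; swap)
import Data.List.Relation.Binary.Permutation.Propositional.Properties as ↭
open import Data.Product using (∃-syntax; _×_; _,_; proj₁; proj₂)
open import Data.Unit using (⊤; tt)
open import Relation.Binary.PropositionalEquality
  using (_≡_; refl; sym; trans; cong; cong₂; subst₂; module ≡-Reasoning)

≈S-refl : ∀ {s} → s ≈S s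
≈S-refl = ↭-refl , ↭-refl

≈S-sym : ∀ {s t} → s ≈S t → t ≈S s
≈S-sym (eΓ , eΔ) = ↭-sym eΓ , ↭-sym eΔ

≈S-trans : ∀ {s t u} → s ≈S t → t ≈S u → s ≈S u
≈S-trans (eΓ , eΔ) (eΓ′ , eΔ′) = ↭-trans eΓ eΓ′ , ↭-trans eΔ eΔ′

infix 4 _∈S_ _⊆S_

_∈S_ : Seq → List Seq → Set
s ∈S Q = Any (s ≈S_) Q

_⊆S_ : List Seq → List Seq → Set
Q ⊆S Q′ = ∀ {s} → s ∈S Q → s ∈S Q′

∈S-resp : ∀ {s t Q} → s ≈S t → t ∈S Q → s ∈S Q
∈S-resp e = Any.map (≈S-trans e)

EndsWith⇒∈S : ∀ {Q s} → EndsWith Q s → s ∈S Q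
EndsWith⇒∈S (ends e) = here (≈S-sym e)

EndsWith-resp : ∀ {Q s t} → EndsWith Q s → s ≈S t → EndsWith Q t
EndsWith-resp (ends e) e′ = ends (≈S-trans e e′)

listSize≡sum : ∀ Γ → listSize Γ ≡ sum (map fmSize Γ)
listSize≡sum []      = refl
listSize≡sum (A ∷ Γ) = cong (fmSize A +_) (listSize≡sum Γ)

listSize-++ : ∀ Γ Δ → listSize (Γ ++ Δ) ≡ listSize Γ + listSize Δ
listSize-++ []      Δ = refl
listSize-++ (A ∷ Γ) Δ = trans (cong (fmSize A +_) (listSize-++ Γ Δ)) (sym (+-assoc (fmSize A) _ _))

listSize-↭ : ∀ {Γ Δ} → Γ ↭ Δ → listSize Γ ≡ listSize Δ
listSize-↭ {Γ} {Δ} p =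
  trans (listSize≡sum Γ) (trans (sum-↭ (↭.map⁺ fmSize p)) (sym (listSize≡sum Δ)))

seqSize-≈S : ∀ {s t} → s ≈S t → seqSize s ≡ seqSize t
seqSize-≈S (eΓ , eΔ) = cong suc (cong₂ _+_ (listSize-↭ eΓ) (listSize-↭ eΔ))

1≤fmSize : ∀ A → 1 ≤ fmSize A
1≤fmSize 𝟘           = s≤s z≤n
1≤fmSize 𝟙           = s≤s z≤n
1≤fmSize (lit _)     = s≤s z≤n
1≤fmSize (ext _)     = s≤s z≤n
1≤fmSize (_ ∨ _)     = s≤s z≤n
1≤fmSize (dec _ _ _) = s≤s z≤n

length≤listSize : ∀ Γ → length Γ ≤ listSize Γ
length≤listSize []      = z≤n
length≤listSize (A ∷ Γ) = +-mono-≤ (1≤fmSize A) (length≤listSize Γ)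

listSize≤length* : ∀ {M Γ} → All (λ A → fmSize A ≤ M) Γ → listSize Γ ≤ length Γ * M
listSize≤length* []         = z≤n
listSize≤length* (A≤M ∷ Γ≤) = +-mono-≤ A≤M (listSize≤length* Γ≤)

-- Derivation trees

-- Rule applications are recorded only up to multiset equality of the
-- conclusion; leaves are hypotheses, i.e. lines of an existing derivation.
data Tree (P : Fm → Set) (H : Seq → Set) : Seq → Set where
  hyp : ∀ {s s′} → H s → s ≈S s′ → Tree P H s′
  by  : ∀ {ps c Γ Δ} → PosRule ps c → c ≈S (Γ , Δ) →
        {{All P Γ}} → {{All P Δ}} → All (Tree P H) ps → Tree P H (Γ , Δ)

infer : ∀ {P H ps Γ Δ} → PosRule ps (Γ , Δ) →
        {{All P Γ}} → {{All P Δ}} → All (Tree P H) ps → Tree P H (Γ , Δ)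
infer r ts = by r ≈S-refl ts

-- The conditions P at the nodes of explicitly written trees are found by
-- instance search.
instance
  All-[] : ∀ {P : Fm → Set} → All P []
  All-[] = []

  All-∷ : ∀ {P : Fm → Set} {A Γ} → {{P A}} → {{All P Γ}} → All P (A ∷ Γ)
  All-∷ {{pA}} {{pΓ}} = pA ∷ pΓ

module _ {P : Fm → Set} {H : Seq → Set} where

  size : ∀ {s} → Tree P H s → ℕ
  sizeAll : ∀ {ps} → All (Tree P H) ps → ℕ
  size (hyp _ _)                = 0
  size (by {Γ = Γ} {Δ} _ _ ts) = seqSize (Γ , Δ) + sizeAll ts
  sizeAll []       = 0
  sizeAll (t ∷ ts) = size t + sizeAll ts

  extent : ∀ {s} → Tree P H s → ℕ
  extentAll : ∀ {ps} → All (Tree P H) ps → ℕ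
  extent (hyp _ _)                = 0
  extent (by {Γ = Γ} {Δ} _ _ ts) = suc (length Γ + length Δ) + extentAll ts
  extentAll []       = 0
  extentAll (t ∷ ts) = extent t + extentAll ts

  cast : ∀ {s s′} → s ≈S s′ → Tree P H s → Tree P H s′
  cast e (hyp h e′)                  = hyp h (≈S-trans e′ e)
  cast e (by r e′ {{pΓ}} {{pΔ}} ts) =
    by r (≈S-trans e′ e) {{↭.All-resp-↭ (proj₁ e) pΓ}} {{↭.All-resp-↭ (proj₂ e) pΔ}} ts

  size-cast : ∀ {s s′} (e : s ≈S s′) (t : Tree P H s) → size (cast e t) ≡ size t
  size-cast e (hyp _ _)      = refl
  size-cast e (by _ _ ts) = cong (_+ sizeAll ts) (sym (seqSize-≈S e))

  extend : ∀ {s} → Tree P H s → List Seq → List Seq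
  extendAll : ∀ {ps} → All (Tree P H) ps → List Seq → List Seq
  extend (hyp _ _)                Q = Q
  extend (by {Γ = Γ} {Δ} _ _ ts) Q = (Γ , Δ) ∷ extendAll ts Q
  extendAll []       Q = Q
  extendAll (t ∷ ts) Q = extend t (extendAll ts Q)

  ⊆S-extend : ∀ {s Q} (t : Tree P H s) → Q ⊆S extend t Q
  ⊆S-extendAll : ∀ {ps Q} (ts : All (Tree P H) ps) → Q ⊆S extendAll ts Q
  ⊆S-extend (hyp _ _)   m = m
  ⊆S-extend (by _ _ ts) m = there (⊆S-extendAll ts m)
  ⊆S-extendAll []       m = m
  ⊆S-extendAll (t ∷ ts) m = ⊆S-extend t (⊆S-extendAll ts m)

  derivSize-extend : ∀ {s} (t : Tree P H s) Q → derivSize (extend t Q) ≡ size t + derivSize Q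
  derivSize-extendAll : ∀ {ps} (ts : All (Tree P H) ps) Q →
                        derivSize (extendAll ts Q) ≡ sizeAll ts + derivSize Q
  derivSize-extend (hyp _ _)                Q = refl
  derivSize-extend (by {Γ = Γ} {Δ} _ _ ts) Q =
    trans (cong (seqSize (Γ , Δ) +_) (derivSize-extendAll ts Q)) (sym (+-assoc (seqSize (Γ , Δ)) _ _))
  derivSize-extendAll []       Q = refl
  derivSize-extendAll (t ∷ ts) Q =
    trans (derivSize-extend t _)
          (trans (cong (size t +_) (derivSize-extendAll ts Q)) (sym (+-assoc (size t) _ _)))

PosLines : (Seq → Set) → List Seq → Set
PosLines Ax Q = Valid PosRule Ax Q × All (SeqAll Positive) Q

module _ {Ax : Seq → Set} {Q₀ : List Seq} where

  extend-valid : ∀ {s Q} → Q₀ ⊆S Q → PosLines Ax Q → (t : Tree Positive (_∈S Q₀) s) →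
                 PosLines Ax (extend t Q) × s ∈S extend t Q
  extendAll-valid : ∀ {ps Q} → Q₀ ⊆S Q → PosLines Ax Q → (ts : All (Tree Positive (_∈S Q₀)) ps) →
                    PosLines Ax (extendAll ts Q) × All (_∈S extendAll ts Q) ps
  extend-valid Q₀⊆Q v (hyp h e) = v , ∈S-resp (≈S-sym e) (Q₀⊆Q h)
  extend-valid Q₀⊆Q v (by r e {{pΓ}} {{pΔ}} ts) with extendAll-valid Q₀⊆Q v ts
  ... | (valid , positive) , premises =
    (rule (_ , _ , r , e , premises) valid , (pΓ , pΔ) ∷ positive) , here ≈S-refl
  extendAll-valid Q₀⊆Q v [] = v , []
  extendAll-valid Q₀⊆Q v (t ∷ ts) with extendAll-valid Q₀⊆Q v ts
  ... | v′ , premises with extend-valid (λ m → ⊆S-extendAll ts (Q₀⊆Q m)) v′ t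
  ... | v″ , conclusion = v″ , conclusion ∷ All.map (⊆S-extend t) premises

record Small (M : ℕ) (A : Fm) : Set where
  field
    positive : Positive A
    bounded  : fmSize A ≤ M

-- For an explicitly written tree extent reduces to a numeral, so this bounds
-- its size without any arithmetic at its nodes.
size≤extent* : ∀ {M H s} → 1 ≤ M → (t : Tree (Small M) H s) → size t ≤ extent t * M
sizeAll≤extentAll* : ∀ {M H ps} → 1 ≤ M → (ts : All (Tree (Small M) H) ps) →
                     sizeAll ts ≤ extentAll ts * M
size≤extent* 1≤M (hyp _ _) = z≤n
size≤extent* {M} 1≤M (by {Γ = Γ} {Δ} _ _ {{pΓ}} {{pΔ}} ts) = begin
  suc (listSize Γ + listSize Δ) + sizeAll ts
    ≤⟨ +-mono-≤ (+-mono-≤ 1≤M (+-mono-≤ (listSize≤length* (All.map Small.bounded pΓ))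
                                         (listSize≤length* (All.map Small.bounded pΔ))))
                (sizeAll≤extentAll* 1≤M ts) ⟩
  (M + (length Γ * M + length Δ * M)) + extentAll ts * M
    ≡⟨ cong (λ n → (M + n) + extentAll ts * M) (sym (*-distribʳ-+ M (length Γ) (length Δ))) ⟩
  suc (length Γ + length Δ) * M + extentAll ts * M
    ≡⟨ sym (*-distribʳ-+ M (suc (length Γ + length Δ)) (extentAll ts)) ⟩
  (suc (length Γ + length Δ) + extentAll ts) * M ∎
  where open ≤-Reasoning
sizeAll≤extentAll* 1≤M []       = z≤n
sizeAll≤extentAll* {M} 1≤M (t ∷ ts) =
  ≤-trans (+-mono-≤ (size≤extent* 1≤M t) (sizeAll≤extentAll* 1≤M ts))
          (≤-reflexive (sym (*-distribʳ-+ M (extent t) (extentAll ts))))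

-- Weakening, and lifting to a side context

weakening-step : ∀ {S S′ l v z} → S′ ≤ S → v ≤ l * S′ + z → S + (v + 0) ≤ suc l * S + z
weakening-step {S} {S′} {l} {v} {z} S′≤S v≤ = begin
  S + (v + 0)      ≡⟨ cong (S +_) (+-identityʳ v) ⟩
  S + v            ≤⟨ +-monoʳ-≤ S (≤-trans v≤ (+-monoˡ-≤ z (*-monoʳ-≤ l S′≤S))) ⟩
  S + (l * S + z)  ≡⟨ sym (+-assoc S (l * S) z) ⟩
  suc l * S + z    ∎
  where open ≤-Reasoning

listSize≤listSize-++ : ∀ G Γ → listSize Γ ≤ listSize (G ++ Γ)
listSize≤listSize-++ G Γ =
  ≤-trans (m≤n+m (listSize Γ) (listSize G)) (≤-reflexive (sym (listSize-++ G Γ)))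

module _ {H : Seq → Set} where

  weakenˡ : ∀ {Γ Δ} Γ′ → All Positive (Γ′ ++ Γ) → All Positive Δ →
            Tree Positive H (Γ , Δ) → Tree Positive H (Γ′ ++ Γ , Δ)
  weakenˡ []                  _          _  t = t
  weakenˡ {Γ} {Δ} (A ∷ Γ′) (pA ∷ pΓ) pΔ t =
    infer (common (wL (Γ′ ++ Γ) Δ A)) {{pA ∷ pΓ}} {{pΔ}} (weakenˡ Γ′ pΓ pΔ t ∷ [])

  weakenʳ : ∀ {Γ Δ} Δ′ → All Positive Γ → All Positive (Δ′ ++ Δ) →
            Tree Positive H (Γ , Δ) → Tree Positive H (Γ , Δ′ ++ Δ)
  weakenʳ []                  _  _          t = t
  weakenʳ {Γ} {Δ} (A ∷ Δ′) pΓ (pA ∷ pΔ) t =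
    infer (common (wR Γ (Δ′ ++ Δ) A)) {{pΓ}} {{pA ∷ pΔ}} (weakenʳ Δ′ pΓ pΔ t ∷ [])

  weaken : ∀ {Γ Δ} G D → All Positive (G ++ Γ) → All Positive (D ++ Δ) →
           Tree Positive H (Γ , Δ) → Tree Positive H (G ++ Γ , D ++ Δ)
  weaken G D pGΓ pDΔ t = weakenˡ G pGΓ pDΔ (weakenʳ D (All.++⁻ʳ G pGΓ) pDΔ t)

  size-weakenˡ : ∀ {Γ Δ} Γ′ pΓ pΔ (t : Tree Positive H (Γ , Δ)) →
                 size (weakenˡ Γ′ pΓ pΔ t) ≤ length Γ′ * seqSize (Γ′ ++ Γ , Δ) + size t
  size-weakenˡ []                  _        _  t = ≤-refl
  size-weakenˡ {Γ} {Δ} (A ∷ Γ′) (_ ∷ pΓ) pΔ t =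
    weakening-step {l = length Γ′} (s≤s (+-monoˡ-≤ (listSize Δ) (m≤n+m _ (fmSize A))))
      (size-weakenˡ Γ′ pΓ pΔ t)

  size-weakenʳ : ∀ {Γ Δ} Δ′ pΓ pΔ (t : Tree Positive H (Γ , Δ)) →
                 size (weakenʳ Δ′ pΓ pΔ t) ≤ length Δ′ * seqSize (Γ , Δ′ ++ Δ) + size t
  size-weakenʳ []                  _  _        t = ≤-refl
  size-weakenʳ {Γ} {Δ} (A ∷ Δ′) pΓ (_ ∷ pΔ) t =
    weakening-step {l = length Δ′} (s≤s (+-monoʳ-≤ (listSize Γ) (m≤n+m _ (fmSize A))))
      (size-weakenʳ Δ′ pΓ pΔ t)

  size-weaken : ∀ {Γ Δ} G D pGΓ pDΔ (t : Tree Positive H (Γ , Δ)) →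
                size (weaken G D pGΓ pDΔ t) ≤ (length G + length D) * seqSize (G ++ Γ , D ++ Δ) + size t
  size-weaken {Γ} {Δ} G D pGΓ pDΔ t = begin
    size (weaken G D pGΓ pDΔ t)
      ≤⟨ size-weakenˡ G pGΓ pDΔ _ ⟩
    length G * S + size (weakenʳ D (All.++⁻ʳ G pGΓ) pDΔ t)
      ≤⟨ +-monoʳ-≤ (length G * S) (size-weakenʳ D _ pDΔ t) ⟩
    length G * S + (length D * seqSize (Γ , D ++ Δ) + size t)
      ≤⟨ +-monoʳ-≤ (length G * S) (+-monoˡ-≤ (size t) (*-monoʳ-≤ (length D) S′≤S)) ⟩
    length G * S + (length D * S + size t)
      ≡⟨ sym (trans (cong (_+ size t) (*-distribʳ-+ S (length G) (length D)))
                    (+-assoc (length G * S) (length D * S) (size t))) ⟩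
    (length G + length D) * S + size t ∎
    where
    open ≤-Reasoning
    S = seqSize (G ++ Γ , D ++ Δ)
    S′≤S : seqSize (Γ , D ++ Δ) ≤ S
    S′≤S = s≤s (+-monoˡ-≤ (listSize (D ++ Δ)) (listSize≤listSize-++ G Γ))

*²-distrib-+ : ∀ W a b → W * (W * a) + W * (W * b) ≡ W * (W * (a + b))
*²-distrib-+ = solve-∀

sum≤suc* : ∀ k w → suc k + w ≤ suc w * suc k
sum≤suc* k w = +-monoʳ-≤ (suc k) (m≤m*n w (suc k))

node-bound : ∀ k w → suc k + w ≤ suc w * (suc w * suc k)
node-bound k w = ≤-trans (sum≤suc* k w) (m≤n*m (suc w * suc k) (suc w))

initial-bound : ∀ {l} k w → l ≤ w → l * (suc k + w) + suc k ≤ suc w * (suc w * suc k)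
initial-bound {l} k w l≤w = begin
  l * (suc k + w) + suc k
    ≤⟨ +-mono-≤ (*-mono-≤ l≤w (sum≤suc* k w)) (m≤n*m (suc k) (suc w)) ⟩
  w * (suc w * suc k) + suc w * suc k
    ≡⟨ +-comm (w * _) _ ⟩
  suc w * (suc w * suc k) ∎
  where open ≤-Reasoning

^3≡ : ∀ n → n ^ 3 ≡ n * (n * n)
^3≡ n = cong (λ m → n * (n * m)) (*-identityʳ n)

cube-bound : ∀ {W M T} E → W ≤ T → M ≤ T → W * (W * (E * M)) ≤ E * T ^ 3
cube-bound {W} {M} {T} E W≤T M≤T = begin
  W * (W * (E * M)) ≡⟨ rearrange W M E ⟩
  E * (W * (W * M)) ≤⟨ *-monoʳ-≤ E (*-mono-≤ W≤T (*-mono-≤ W≤T M≤T)) ⟩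
  E * (T * (T * T)) ≡⟨ cong (E *_) (sym (^3≡ T)) ⟩
  E * T ^ 3         ∎
  where
  open ≤-Reasoning
  rearrange : ∀ W M E → W * (W * (E * M)) ≡ E * (W * (W * M))
  rearrange = solve-∀

module Lift (G D : List Fm) (pG : All Positive G) (pD : All Positive D) where

  infix 30 _⁺

  _⁺ : Seq → Seq
  (Γ , Δ) ⁺ = Γ ++ G , Δ ++ D

  ⁺-resp : ∀ {s t} → s ≈S t → s ⁺ ≈S t ⁺
  ⁺-resp (eΓ , eΔ) = ↭.++⁺ʳ G eΓ , ↭.++⁺ʳ D eΔ

  w : ℕ
  w = listSize G + listSize D

  seqSize-⁺ : ∀ s → seqSize (s ⁺) ≡ seqSize s + w
  seqSize-⁺ (Γ , Δ) = cong suc (begin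
    listSize (Γ ++ G) + listSize (Δ ++ D)
      ≡⟨ cong₂ _+_ (listSize-++ Γ G) (listSize-++ Δ D) ⟩
    (listSize Γ + listSize G) + (listSize Δ + listSize D)
      ≡⟨ interchange (listSize Γ) (listSize G) _ _ ⟩
    (listSize Γ + listSize Δ) + w ∎)
    where
    open ≡-Reasoning
    interchange : ∀ a b c d → (a + b) + (c + d) ≡ (a + c) + (b + d)
    interchange = solve-∀

  liftRule : ∀ {p ps c} → PosRule (p ∷ ps) c → PosRule (map _⁺ (p ∷ ps)) (c ⁺)
  liftRule (common (cut Γ Δ A))  = common (cut (Γ ++ G) (Δ ++ D) A)
  liftRule (common (wL Γ Δ A))   = common (wL (Γ ++ G) (Δ ++ D) A)
  liftRule (common (wR Γ Δ A))   = common (wR (Γ ++ G) (Δ ++ D) A)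
  liftRule (common (cL Γ Δ A))   = common (cL (Γ ++ G) (Δ ++ D) A)
  liftRule (common (cR Γ Δ A))   = common (cR (Γ ++ G) (Δ ++ D) A)
  liftRule (common (∨L Γ Δ A B)) = common (∨L (Γ ++ G) (Δ ++ D) A B)
  liftRule (common (∨R Γ Δ A B)) = common (∨R (Γ ++ G) (Δ ++ D) A B)
  liftRule (pdL Γ Δ A x B)       = pdL (Γ ++ G) (Δ ++ D) A x B
  liftRule (pdR Γ Δ A x B)       = pdR (Γ ++ G) (Δ ++ D) A x B

  module _ {P : Fm → Set} {H : Seq → Set} (positive : ∀ {A} → P A → Positive A) where

    -- Every rule except an initial sequent carries its context along; initial
    -- sequents are weakened by the side formulas.
    lift : ∀ {s} → Tree P (λ s → H (s ⁺)) s → Tree Positive H (s ⁺)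
    liftAll : ∀ {ps} → All (Tree P (λ s → H (s ⁺))) ps → All (Tree Positive H) (map _⁺ ps)
    lift (hyp h e) = hyp h (⁺-resp e)
    lift (by {[]} {Γ = Γ} {Δ} r e {{pΓ}} {{pΔ}} []) =
      cast (↭.++-comm G Γ , ↭.++-comm D Δ)
        (weaken G D (All.++⁺ pG (All.map positive pΓ)) (All.++⁺ pD (All.map positive pΔ))
          (by r e {{All.map positive pΓ}} {{All.map positive pΔ}} []))
    lift (by {_ ∷ _} r e {{pΓ}} {{pΔ}} ts) =
      by (liftRule r) (⁺-resp e)
         {{All.++⁺ (All.map positive pΓ) pG}} {{All.++⁺ (All.map positive pΔ) pD}} (liftAll ts)
    liftAll []       = []
    liftAll (t ∷ ts) = lift t ∷ liftAll ts

    size-lift : ∀ {s} (t : Tree P (λ s → H (s ⁺)) s) → size (lift t) ≤ suc w * (suc w * size t)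
    sizeAll-liftAll : ∀ {ps} (ts : All (Tree P (λ s → H (s ⁺))) ps) →
                      sizeAll (liftAll ts) ≤ suc w * (suc w * sizeAll ts)
    size-lift (hyp _ _) = z≤n
    size-lift (by {[]} {Γ = Γ} {Δ} r e {{pΓ}} {{pΔ}} []) = begin
      size (lift (by r e []))
        ≡⟨ size-cast (↭.++-comm G Γ , ↭.++-comm D Δ) weakened ⟩
      size weakened
        ≤⟨ size-weaken G D _ _ _ ⟩
      (length G + length D) * seqSize (G ++ Γ , D ++ Δ) + (seqSize (Γ , Δ) + 0)
        ≡⟨ cong₂ (λ S s → (length G + length D) * S + s) lifted-size (+-identityʳ _) ⟩
      (length G + length D) * (seqSize (Γ , Δ) + w) + seqSize (Γ , Δ)
        ≤⟨ initial-bound _ w (+-mono-≤ (length≤listSize G) (length≤listSize D)) ⟩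
      suc w * (suc w * seqSize (Γ , Δ))
        ≡⟨ cong (λ s → suc w * (suc w * s)) (sym (+-identityʳ _)) ⟩
      suc w * (suc w * (seqSize (Γ , Δ) + 0)) ∎
      where
      open ≤-Reasoning
      weakened = weaken G D (All.++⁺ pG (All.map positive pΓ)) (All.++⁺ pD (All.map positive pΔ))
                  (by r e {{All.map positive pΓ}} {{All.map positive pΔ}} [])
      lifted-size : seqSize (G ++ Γ , D ++ Δ) ≡ seqSize (Γ , Δ) + w
      lifted-size = trans (seqSize-≈S (↭.++-comm G Γ , ↭.++-comm D Δ)) (seqSize-⁺ (Γ , Δ))
    size-lift (by {_ ∷ _} {Γ = Γ} {Δ} r e ts) = begin
      seqSize ((Γ , Δ) ⁺) + sizeAll (liftAll ts)
        ≤⟨ +-mono-≤ (≤-trans (≤-reflexive (seqSize-⁺ (Γ , Δ)))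
                             (node-bound (listSize Γ + listSize Δ) w))
                    (sizeAll-liftAll ts) ⟩
      suc w * (suc w * seqSize (Γ , Δ)) + suc w * (suc w * sizeAll ts)
        ≡⟨ *²-distrib-+ (suc w) (seqSize (Γ , Δ)) (sizeAll ts) ⟩
      suc w * (suc w * (seqSize (Γ , Δ) + sizeAll ts)) ∎
      where open ≤-Reasoning
    sizeAll-liftAll []       = z≤n
    sizeAll-liftAll (t ∷ ts) =
      ≤-trans (+-mono-≤ (size-lift t) (sizeAll-liftAll ts))
              (≤-reflexive (*²-distrib-+ (suc w) (size t) (sizeAll ts)))

  size-lift-bounded : ∀ {M H Γ Δ E} → 1 ≤ M → M ≤ seqSize (Γ , Δ) →
                      (t : Tree (Small M) (λ s → H (s ⁺)) (Γ , Δ)) → extent t ≤ E →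
                      size (lift {H = H} Small.positive t) ≤ E * seqSize ((Γ , Δ) ⁺) ^ 3
  size-lift-bounded {M} {H} {Γ} {Δ} {E} 1≤M M≤s t extent≤E = begin
    size (lift {H = H} Small.positive t)  ≤⟨ size-lift {H = H} Small.positive t ⟩
    suc w * (suc w * size t)              ≤⟨ *-monoʳ-≤ (suc w) (*-monoʳ-≤ (suc w) size≤ ) ⟩
    suc w * (suc w * (E * M))             ≤⟨ cube-bound E W≤ M≤ ⟩
    E * seqSize ((Γ , Δ) ⁺) ^ 3           ∎
    where
    open ≤-Reasoning
    size≤ : size t ≤ E * M
    size≤ = ≤-trans (size≤extent* 1≤M t) (*-monoˡ-≤ M extent≤E)
    W≤ : suc w ≤ seqSize ((Γ , Δ) ⁺)
    W≤ = ≤-trans (s≤s (m≤n+m w (listSize Γ + listSize Δ))) (≤-reflexive (sym (seqSize-⁺ (Γ , Δ))))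
    M≤ : M ≤ seqSize ((Γ , Δ) ⁺)
    M≤ = ≤-trans M≤s
           (≤-trans (m≤m+n (seqSize (Γ , Δ)) w) (≤-reflexive (sym (seqSize-⁺ (Γ , Δ)))))

-- Context-free derivations for the decision rules

fmSize-∨ˡ : ∀ A B → fmSize A ≤ fmSize (A ∨ B)
fmSize-∨ˡ A B = m≤n⇒m≤1+n (m≤m+n (fmSize A) (fmSize B))

fmSize-∨ʳ : ∀ A B → fmSize B ≤ fmSize (A ∨ B)
fmSize-∨ʳ A B = m≤n⇒m≤1+n (m≤n+m (fmSize B) (fmSize A))

fmSize-pd : ∀ A x C → fmSize C ≤ fmSize (pd A x C)
fmSize-pd A x C = ≤-trans (fmSize-∨ʳ A C) (m≤n⇒m≤1+n (m≤n⇒m≤1+n (m≤n+m _ (fmSize A))))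

-- Taking the rule as a pair makes the resulting tree a by-node even for a
-- variable literal, so that extent still computes.
initial : ∀ {P H Γ Δ} → ∃[ c ] (PosRule [] c × c ≈S (Γ , Δ)) →
          {{All P Γ}} → {{All P Δ}} → Tree P H (Γ , Δ)
initial (_ , r , e) = by r e []

complementˡ : ∀ x → ∃[ c ] (PosRule [] c × c ≈S (lit x ∷ lit (bar x) ∷ [] , []))
complementˡ (pos p) = _ , compL p , ≈S-refl
complementˡ (neg p) = _ , compL p , swap _ _ ↭-refl , ↭-refl

complementʳ : ∀ x → ∃[ c ] (PosRule [] c × c ≈S ([] , lit x ∷ lit (bar x) ∷ []))
complementʳ (pos p) = _ , compR p , ≈S-refl
complementʳ (neg p) = _ , compR p , ↭-refl , swap _ _ ↭-refl

-- The extent of decR-tree; that of decL-tree is 24.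
K : ℕ
K = 77

module Decision (a b : Fm) (x : Lit) (pa : Positive a) (pb : Positive b) where

  X Y F E : Fm
  X = lit x
  Y = lit (bar x)
  F = pd 𝟘 (bar x) a
  E = pd 𝟘 x b

  M : ℕ
  M = fmSize (F ∨ E)

  instance
    small-𝟘 : Small M 𝟘
    small-𝟘 = record { positive = 𝟘 ; bounded = s≤s z≤n }

    small-X : Small M X
    small-X = record { positive = lit x ; bounded = s≤s z≤n }

    small-Y : Small M Y
    small-Y = record { positive = lit (bar x) ; bounded = s≤s z≤n }

    small-a : Small M a
    small-a = record { positive = pa ; bounded = ≤-trans (fmSize-pd 𝟘 (bar x) a) (fmSize-∨ˡ F E) }

    small-b : Small M b
    small-b = record { positive = pb ; bounded = ≤-trans (fmSize-pd 𝟘 x b) (fmSize-∨ʳ F E) }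

    small-F : Small M F
    small-F = record { positive = posPd (bar x) 𝟘 pa ; bounded = fmSize-∨ˡ F E }

    small-E : Small M E
    small-E = record { positive = posPd x 𝟘 pb ; bounded = fmSize-∨ʳ F E }

    small-F∨E : Small M (F ∨ E)
    small-F∨E = record { positive = Small.positive small-F ∨ Small.positive small-E ; bounded = ≤-refl }

  module _ {H : Seq → Set} where

    𝟘⊢ : Tree (Small M) H (𝟘 ∷ [] , [])
    𝟘⊢ = infer (common init0) []

    -- x̄, a ⊢ comes from the first premise a ⊢ x and x, x̄ ⊢ by a cut on x; the
    -- second premise is already x, b ⊢.
    decL-tree : H (a ∷ [] , X ∷ []) → H (X ∷ b ∷ [] , []) → Tree (Small M) H ((F ∨ E) ∷ [] , [])
    decL-tree h₁ h₂ =
      infer (common (∨L [] [] F E))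
        ( infer (pdL [] [] 𝟘 (bar x) a)
            ( 𝟘⊢
            ∷ infer (common (cut (Y ∷ a ∷ []) [] X))
                ( infer (common (wL (a ∷ []) (X ∷ []) Y)) (hyp h₁ ≈S-refl ∷ [])
                ∷ by (common (wL (X ∷ Y ∷ []) [] a))
                     (↭-trans (swap a X ↭-refl) (prep X (swap a Y ↭-refl)) , ↭-refl)
                     (initial (complementˡ x) ∷ [])
                ∷ [])
            ∷ [])
        ∷ infer (pdL [] [] 𝟘 x b) (𝟘⊢ ∷ hyp h₂ ≈S-refl ∷ [])
        ∷ [])

    -- Both premises of pd 𝟘 x̄ a on the right have the form ⊢ 𝟘, v, E; each comes
    -- from ⊢ x, v (the complement sequent for v = x̄, the first premise for
    -- v = a) and ⊢ b, v, obtained by a cut on x with the second premise.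
    decR-tree : H ([] , a ∷ X ∷ []) → H (X ∷ [] , b ∷ []) → Tree (Small M) H ([] , (F ∨ E) ∷ [])
    decR-tree h₁ h₂ =
      infer (common (∨R [] [] F E))
        ( infer (pdR [] (E ∷ []) 𝟘 (bar x) a)
            ( ⊢E-beside Y (initial (complementʳ x))
            ∷ ⊢E-beside a (hyp h₁ (↭-refl , swap a X ↭-refl))
            ∷ [])
        ∷ [])
      where
      cut-X : ∀ v → {{Small M v}} →
              Tree (Small M) H ([] , X ∷ v ∷ []) → Tree (Small M) H ([] , b ∷ v ∷ [])
      cut-X v t =
        infer (common (cut [] (b ∷ v ∷ []) X))
          ( by (common (wR [] (X ∷ v ∷ []) b)) (↭-refl , swap b X ↭-refl) (t ∷ [])
          ∷ by (common (wR (X ∷ []) (b ∷ []) v)) (↭-refl , swap v b ↭-refl) (hyp h₂ ≈S-refl ∷ [])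
          ∷ [])
      pad : ∀ u v → {{Small M u}} → {{Small M v}} →
            Tree (Small M) H ([] , u ∷ v ∷ []) → Tree (Small M) H ([] , 𝟘 ∷ u ∷ 𝟘 ∷ v ∷ [])
      pad u v t =
        by (common (wR [] (𝟘 ∷ u ∷ v ∷ []) 𝟘)) (↭-refl , prep 𝟘 (swap 𝟘 u ↭-refl))
          (infer (common (wR [] (u ∷ v ∷ []) 𝟘)) (t ∷ []) ∷ [])
      ⊢E-beside : ∀ v → {{Small M v}} →
                  Tree (Small M) H ([] , X ∷ v ∷ []) → Tree (Small M) H ([] , 𝟘 ∷ v ∷ E ∷ [])
      ⊢E-beside v t =
        by (pdR [] (𝟘 ∷ v ∷ []) 𝟘 x b)
           (↭-refl , ↭-trans (swap E 𝟘 ↭-refl) (prep 𝟘 (swap E v ↭-refl)))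
          (pad X v t ∷ pad b v (cut-X v t) ∷ [])

    extent-decL-tree : ∀ h₁ h₂ → extent (decL-tree h₁ h₂) ≤ K
    extent-decL-tree h₁ h₂ = m≤m+n 24 53

    extent-decR-tree : ∀ h₁ h₂ → extent (decR-tree h₁ h₂) ≤ K
    extent-decR-tree h₁ h₂ = ≤-refl

  M≤seqSizeˡ : M ≤ seqSize ((F ∨ E) ∷ [] , [])
  M≤seqSizeˡ = ≤-trans (m≤m+n M 0) (m≤n⇒m≤1+n (m≤m+n (M + 0) 0))

  M≤seqSizeʳ : M ≤ seqSize ([] , (F ∨ E) ∷ [])
  M≤seqSizeʳ = m≤n⇒m≤1+n (m≤m+n M 0)

-- The translation N

N-positive : ∀ A → Positive (N A)
N-positive 𝟘           = 𝟘
N-positive 𝟙           = 𝟙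
N-positive (lit x)     = lit x
N-positive (ext i)     = ext i
N-positive (A ∨ B)     = N-positive A ∨ N-positive B
N-positive (dec A x B) = posPd (bar x) 𝟘 (N-positive A) ∨ posPd x 𝟘 (N-positive B)

map-N-positive : ∀ Γ → All Positive (map N Γ)
map-N-positive []      = []
map-N-positive (A ∷ Γ) = N-positive A ∷ map-N-positive Γ

Nseq : Seq → Seq
Nseq (Γ , Δ) = map N Γ , map N Δ

Nseq-positive : ∀ s → SeqAll Positive (Nseq s)
Nseq-positive (Γ , Δ) = map-N-positive Γ , map-N-positive Δ

Nseq-resp : ∀ {s t} → s ≈S t → Nseq s ≈S Nseq t
Nseq-resp (eΓ , eΔ) = ↭.map⁺ N eΓ , ↭.map⁺ N eΔ

suc-6*-slack : ∀ a b → suc (6 * a + 6 * b) + 5 ≡ 6 * suc (a + b)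
suc-6*-slack = solve-∀

fmSize-N : ∀ A → fmSize (N A) ≤ 6 * fmSize A
fmSize-N 𝟘       = s≤s z≤n
fmSize-N 𝟙       = s≤s z≤n
fmSize-N (lit _) = s≤s z≤n
fmSize-N (ext _) = s≤s z≤n
fmSize-N (A ∨ B) = begin
  suc (fmSize (N A) + fmSize (N B)) ≤⟨ s≤s (+-mono-≤ (fmSize-N A) (fmSize-N B)) ⟩
  suc (6 * fmSize A + 6 * fmSize B)
    ≤⟨ m+n≤o⇒m≤o _ (≤-reflexive (suc-6*-slack (fmSize A) (fmSize B))) ⟩
  6 * fmSize (A ∨ B)                ∎
  where open ≤-Reasoning
fmSize-N (dec A x B) = begin
  suc ((5 + fmSize (N A)) + (5 + fmSize (N B)))
    ≤⟨ s≤s (+-mono-≤ (+-monoʳ-≤ 5 (fmSize-N A)) (+-monoʳ-≤ 5 (fmSize-N B))) ⟩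
  suc ((5 + 6 * fmSize A) + (5 + 6 * fmSize B))
    ≤⟨ m+n≤o⇒m≤o _ (≤-reflexive (slack (fmSize A) (fmSize B))) ⟩
  6 * fmSize (dec A x B) ∎
  where
  open ≤-Reasoning
  slack : ∀ a b → suc ((5 + 6 * a) + (5 + 6 * b)) + 1 ≡ 6 * suc (suc (a + b))
  slack = solve-∀

listSize-map-N : ∀ Γ → listSize (map N Γ) ≤ 6 * listSize Γ
listSize-map-N []      = z≤n
listSize-map-N (A ∷ Γ) =
  ≤-trans (+-mono-≤ (fmSize-N A) (listSize-map-N Γ))
          (≤-reflexive (sym (*-distribˡ-+ 6 (fmSize A) (listSize Γ))))

seqSize-Nseq : ∀ s → seqSize (Nseq s) ≤ 6 * seqSize s
seqSize-Nseq (Γ , Δ) =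
  ≤-trans (s≤s (+-mono-≤ (listSize-map-N Γ) (listSize-map-N Δ)))
          (m+n≤o⇒m≤o _ (≤-reflexive (suc-6*-slack (listSize Γ) (listSize Δ))))

Common-N : ∀ {ps c} → Common ps c → Common (map Nseq ps) (Nseq c)
Common-N init0        = init0
Common-N init1        = init1
Common-N (initx x)    = initx x
Common-N (cut Γ Δ A)  = cut (map N Γ) (map N Δ) (N A)
Common-N (wL Γ Δ A)   = wL (map N Γ) (map N Δ) (N A)
Common-N (wR Γ Δ A)   = wR (map N Γ) (map N Δ) (N A)
Common-N (cL Γ Δ A)   = cL (map N Γ) (map N Δ) (N A)
Common-N (cR Γ Δ A)   = cR (map N Γ) (map N Δ) (N A)
Common-N (∨L Γ Δ A B) = ∨L (map N Γ) (map N Δ) (N A) (N B)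
Common-N (∨R Γ Δ A B) = ∨R (map N Γ) (map N Δ) (N A) (N B)

lookup-map-N : ∀ 𝒜 (i : Fin (length 𝒜)) →
               ∃[ j ] (toℕ j ≡ toℕ i × lookup (map N 𝒜) j ≡ N (lookup 𝒜 i))
lookup-map-N (A ∷ 𝒜) zero    = zero , refl , refl
lookup-map-N (A ∷ 𝒜) (suc i) with lookup-map-N 𝒜 i
... | j , toℕ-j , lookup-j = suc j , cong suc toℕ-j , lookup-j

ExtAx-N : ∀ {𝒜 s} → ExtAx 𝒜 s → ExtAx (map N 𝒜) (Nseq s)
ExtAx-N {𝒜} (ax→ i) with lookup-map-N 𝒜 i
... | j , toℕ-j , lookup-j =
  subst₂ (λ k B → ExtAx (map N 𝒜) (ext k ∷ [] , B ∷ [])) toℕ-j lookup-j (ax→ j)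
ExtAx-N {𝒜} (ax← i) with lookup-map-N 𝒜 i
... | j , toℕ-j , lookup-j =
  subst₂ (λ k B → ExtAx (map N 𝒜) (B ∷ [] , ext k ∷ [])) toℕ-j lookup-j (ax← j)

-- Simulating an eLNDT derivation line by line

n≤K*n^3 : ∀ n → suc n ≤ K * suc n ^ 3
n≤K*n^3 n = begin
  suc n                     ≤⟨ m≤m*n (suc n) (suc n * suc n) ⟩
  suc n * (suc n * suc n)   ≡⟨ sym (^3≡ (suc n)) ⟩
  suc n ^ 3                 ≤⟨ m≤n*m (suc n ^ 3) K ⟩
  K * suc n ^ 3             ∎
  where open ≤-Reasoning

record Extension (Ax : Seq → Set) (Q : List Seq) (s : Seq) : Set where
  field
    derivation : List Seq
    valid      : PosLines Ax derivation
    keeps      : Q ⊆S derivation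
    ending     : EndsWith derivation s
    cost       : derivSize derivation ≤ K * seqSize s ^ 3 + derivSize Q

module _ {Ax : Seq → Set} {Q : List Seq} where

  addLine : ∀ {s} → PosLines Ax Q → SeqAll Positive s →
            (Valid PosRule Ax Q → Valid PosRule Ax (s ∷ Q)) → Extension Ax Q s
  addLine {s = Γ , Δ} (v , positive) pS step = record
    { derivation = (Γ , Δ) ∷ Q
    ; valid      = step v , pS ∷ positive
    ; keeps      = there
    ; ending     = ends ≈S-refl
    ; cost       = +-monoˡ-≤ (derivSize Q) (n≤K*n^3 (listSize Γ + listSize Δ))
    }

  addTree : ∀ {s} → PosLines Ax Q → (t : Tree Positive (_∈S Q) s) → EndsWith (extend t Q) s →
            size t ≤ K * seqSize s ^ 3 → Extension Ax Q s
  addTree v t e bound = record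
    { derivation = extend t Q
    ; valid      = proj₁ (extend-valid (λ m → m) v t)
    ; keeps      = ⊆S-extend t
    ; ending     = e
    ; cost       = ≤-trans (≤-reflexive (derivSize-extend t Q)) (+-monoˡ-≤ (derivSize Q) bound)
    }

translateRule : ∀ {Ax Q ps c} → LNDTRule ps c → All (_∈S Q) (map Nseq ps) → PosLines Ax Q →
                Extension Ax Q (Nseq c)
translateRule {c = c} (common r) premises v =
  addLine v (Nseq-positive c) (rule (_ , _ , common (Common-N r) , ≈S-refl , premises))
translateRule {Q = Q} (decL Γ Δ A x B) (h₁ ∷ h₂ ∷ []) v =
  addTree v (lift {H = _∈S Q} Small.positive t) (ends ≈S-refl)
    (size-lift-bounded {H = _∈S Q} {E = K} (s≤s z≤n) M≤seqSizeˡ t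
       (extent-decL-tree {H = λ s → s ⁺ ∈S Q} h₁ h₂))
  where
  open Lift (map N Γ) (map N Δ) (map-N-positive Γ) (map-N-positive Δ)
  open Decision (N A) (N B) x (N-positive A) (N-positive B)
  t : Tree (Small M) (λ s → s ⁺ ∈S Q) ((F ∨ E) ∷ [] , [])
  t = decL-tree h₁ h₂
translateRule {Q = Q} (decR Γ Δ A x B) (h₁ ∷ h₂ ∷ []) v =
  addTree v (lift {H = _∈S Q} Small.positive t) (ends ≈S-refl)
    (size-lift-bounded {H = _∈S Q} {E = K} (s≤s z≤n) M≤seqSizeʳ t
       (extent-decR-tree {H = λ s → s ⁺ ∈S Q} h₁ h₂))
  where
  open Lift (map N Γ) (map N Δ) (map-N-positive Γ) (map-N-positive Δ)
  open Decision (N A) (N B) x (N-positive A) (N-positive B)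
  t : Tree (Small M) (λ s → s ⁺ ∈S Q) ([] , (F ∨ E) ∷ [])
  t = decR-tree h₁ h₂

C : ℕ
C = 216 * K

cube-superadditive : ∀ m n → m ^ 3 + n ^ 3 ≤ (m + n) ^ 3
cube-superadditive m n = begin
  m ^ 3 + n ^ 3                    ≡⟨ cong₂ _+_ (^3≡ m) (^3≡ n) ⟩
  m * (m * m) + n * (n * n)        ≤⟨ m≤m+n _ (3 * (m * n * (m + n))) ⟩
  m * (m * m) + n * (n * n) + 3 * (m * n * (m + n)) ≡⟨ binomial m n ⟩
  (m + n) * ((m + n) * (m + n))    ≡⟨ sym (^3≡ (m + n)) ⟩
  (m + n) ^ 3                      ∎
  where
  open ≤-Reasoning
  binomial : ∀ m n → m * (m * m) + n * (n * n) + 3 * (m * n * (m + n)) ≡ (m + n) * ((m + n) * (m + n))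
  binomial = solve-∀

translated-cube : ∀ k s → k * seqSize (Nseq s) ^ 3 ≤ 216 * k * seqSize s ^ 3
translated-cube k s = begin
  k * seqSize (Nseq s) ^ 3            ≤⟨ *-monoʳ-≤ k (^-monoˡ-≤ 3 (seqSize-Nseq s)) ⟩
  k * (6 * seqSize s) ^ 3             ≡⟨ cong (k *_) (^3≡ (6 * seqSize s)) ⟩
  k * (6 * x * (6 * x * (6 * x)))     ≡⟨ six-cubed k x ⟩
  216 * k * (x * (x * x))             ≡⟨ cong (216 * k *_) (sym (^3≡ x)) ⟩
  216 * k * seqSize s ^ 3             ∎
  where
  open ≤-Reasoning
  x = seqSize s
  six-cubed : ∀ k x → k * (6 * x * (6 * x * (6 * x))) ≡ 216 * k * (x * (x * x))
  six-cubed = solve-∀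

module Translation (𝒜 : List Fm) where

  Ax : Seq → Set
  Ax = ExtAx (map N 𝒜)

  LastTranslated : List Seq → List Seq → Set
  LastTranslated []      Q = ⊤
  LastTranslated (s ∷ _) Q = EndsWith Q (Nseq s)

  record Simulation (P : List Seq) : Set where
    field
      derivation : List Seq
      valid      : PosLines Ax derivation
      covers     : ∀ {p} → p ∈S P → Nseq p ∈S derivation
      ending     : LastTranslated P derivation
      bound      : derivSize derivation ≤ C * derivSize P ^ 3

  simulateLine : ∀ {ss s c} (S : Simulation ss) → Extension Ax (Simulation.derivation S) (Nseq c) →
                 c ≈S s → Simulation (s ∷ ss)
  simulateLine {ss} {s} {c} S X e = record
    { derivation = X.derivation
    ; valid      = X.valid
    ; covers     = covers
    ; ending     = EndsWith-resp X.ending (Nseq-resp e)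
    ; bound      = begin
        derivSize X.derivation
          ≤⟨ X.cost ⟩
        K * seqSize (Nseq c) ^ 3 + derivSize Q
          ≤⟨ +-mono-≤ (translated-cube K c) S.bound ⟩
        C * seqSize c ^ 3 + C * derivSize ss ^ 3
          ≡⟨ cong (λ n → C * n ^ 3 + C * derivSize ss ^ 3) (seqSize-≈S e) ⟩
        C * seqSize s ^ 3 + C * derivSize ss ^ 3
          ≡⟨ sym (*-distribˡ-+ C (seqSize s ^ 3) (derivSize ss ^ 3)) ⟩
        C * (seqSize s ^ 3 + derivSize ss ^ 3)
          ≤⟨ *-monoʳ-≤ C (cube-superadditive (seqSize s) (derivSize ss)) ⟩
        C * derivSize (s ∷ ss) ^ 3 ∎
    }
    where
    open ≤-Reasoning
    module S = Simulation S
    module X = Extension X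
    Q = S.derivation
    covers : ∀ {p} → p ∈S s ∷ ss → Nseq p ∈S X.derivation
    covers (here p≈s) = ∈S-resp (Nseq-resp (≈S-trans p≈s (≈S-sym e))) (EndsWith⇒∈S X.ending)
    covers (there p∈) = X.keeps (S.covers p∈)

  simulate : ∀ {P} → Valid LNDTRule (ExtAx 𝒜) P → Simulation P
  simulate [] = record
    { derivation = [] ; valid = [] , [] ; covers = λ () ; ending = tt ; bound = z≤n }
  simulate (ax {s} a v) =
    simulateLine S (addLine (Simulation.valid S) (Nseq-positive s) (ax (ExtAx-N a))) ≈S-refl
    where S = simulate v
  simulate (rule (_ , _ , r , e , premises) v) =
    simulateLine S
      (translateRule r (All.map⁺ (All.map (Simulation.covers S) premises)) (Simulation.valid S)) e
    where S = simulate v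

  translate : ∀ {P s} → IsELNDTDerivation 𝒜 P s →
              ∃[ Q ] (IsPosDerivation (map N 𝒜) Q (Nseq s) × derivSize Q ≤ C * suc (derivSize P) ^ 3)
  translate {s ∷ ss} (v , _ , ends e) =
    derivation , (proj₁ valid , proj₂ valid , EndsWith-resp ending (Nseq-resp e)) ,
    ≤-trans bound (*-monoʳ-≤ C (^-monoˡ-≤ 3 (n≤1+n (derivSize (s ∷ ss)))))
    where open Simulation (simulate v)

mainTheorem4 : ∃[ c ] ∃[ k ] ((𝒜 : List Fm) → WellFormedExt 𝒜 →
                 (Γ Δ : List Fm) (P : List Seq) → IsELNDTDerivation 𝒜 P (Γ , Δ) →
                 ∃[ Q ] (IsPosDerivation (map N 𝒜) Q (map N Γ , map N Δ)
                         × derivSize Q ≤ c * suc (derivSize P) ^ k))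
mainTheorem4 = C , 3 , λ 𝒜 _ _ _ _ → Translation.translate 𝒜
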